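{- For conjunctive systems, considering unconditionally fair initializing runs, for every $n \geq 1$: $$(A,B)^{(1,1)} \models \mathsf{E}_{uncond}\, h(A,B_1) \;\Longleftarrow\; (A,B)^{(1,n)} \models \mathsf{E}_{uncond}\, h(A,B_1).$$
   Context: A process template is a transition system $U=(Q_U,\mathit{init}_U,\Sigma_U,\delta_U)$ with finite state set, initial state, input alphabet and guarded transition relation $\delta_U \subseteq Q_U\times\Sigma_U\times 2^{Q_A\cup Q_B}\times Q_U$. The system $(A,B)^{(1,n)}$ is the interleaving parallel composition of one copy of template $A$ and $n$ copies $B_1,\dots,B_n$ of template $B$: in each step exactly one process takes a local transition whose guard is satisfied. In a conjunctive system, the guard $g$ of a transition of process $p$ is satisfied iff every process other than $p$ is currently in a local state belonging to $g$; it is assumed that $\mathit{init}_A$ and $\mathit{init}_B$ belong to every guard. A run is a maximal path from the initial global state; it is unconditionally fair if it is infinite and every process moves infinitely often, and it is initializing if every process that moves infinitely often visits its initial state infinitely often. $h(A,B_1)$ is an LTL formula without the next-time operator $\mathsf{X}$, over local states and inputs of processes $A$ and $B_1$. $\mathsf{E}_{uncond}\, h(A,B_1)$ holds iff there exists an (here: initializing) unconditionally fair run satisfying $h(A,B_1)$. -}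

module Defs where

open import Data.Nat using (ℕ; zero; suc; _≤_; _<_; NonZero)
open import Data.Fin using (Fin; zero; suc)
open import Data.Fin.Subset using (Subset; _∈_)
open import Data.Product using (Σ; ∃; _×_; _,_; proj₁; proj₂)
open import Data.Unit using (⊤)
open import Relation.Binary.PropositionalEquality using (_≡_; _≢_)
open import Relation.Nullary using (¬_)

-- States of template A are Fin qa, states of template B are Fin qb.
-- A guard is a subset of Q_A ∪ Q_B (disjoint union), represented as a
-- pair of subsets.

Guard : ℕ → ℕ → Set
Guard qa qb = Subset qa × Subset qb

record Template (qa qb q s : ℕ) : Set₁ where
  field
    init : Fin q
    δ    : Fin q → Fin s → Guard qa qb → Fin q → Set

open Template public

InitInGuards : ∀ {qa qb sa sb} → Template qa qb qa sa → Template qa qb qb sb → Set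
InitInGuards A B =
  (∀ q σ g q' → δ A q σ g q' → (init A ∈ proj₁ g) × (init B ∈ proj₂ g)) ×
  (∀ q σ g q' → δ B q σ g q' → (init A ∈ proj₁ g) × (init B ∈ proj₂ g))

data Proc (n : ℕ) : Set where
  procA : Proc n
  procB : Fin n → Proc n

module System {qa qb sa sb : ℕ}
              (A : Template qa qb qa sa) (B : Template qa qb qb sb) where

  GState : ℕ → Set
  GState n = Fin qa × (Fin n → Fin qb)

  GInput : ℕ → Set
  GInput n = Fin sa × (Fin n → Fin sb)

  -- Conjunctive guard semantics: a transition of process p with guard g
  -- is enabled iff every process other than p is in a state of g.  Inputs: the input
  -- of a process persists until that process moves.
  Step : ∀ {n} → Proc n → GState n → GInput n → GState n → GInput n → Set
  Step {n} procA (a , bs) (σ , τs) (a' , bs') (σ' , τs') =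
    Σ (Guard qa qb) λ g →
      δ A a σ g a' ×
      (∀ i → bs i ∈ proj₂ g) ×
      (∀ i → bs' i ≡ bs i) ×
      (∀ i → τs' i ≡ τs i)
  Step {n} (procB i) (a , bs) (σ , τs) (a' , bs') (σ' , τs') =
    Σ (Guard qa qb) λ g →
      δ B (bs i) (τs i) g (bs' i) ×
      (a ∈ proj₁ g) ×
      (∀ j → j ≢ i → bs j ∈ proj₂ g) ×
      (a' ≡ a) ×
      (∀ j → j ≢ i → bs' j ≡ bs j) ×
      (σ' ≡ σ) ×
      (∀ j → j ≢ i → τs' j ≡ τs j)

  IsInit : ∀ {n} → Proc n → GState n → Set
  IsInit procA     (a , bs) = a ≡ init A
  IsInit (procB i) (a , bs) = bs i ≡ init B

  -- An infinite path of (A,B)^(1,n) from the initial global state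
  -- (infinite paths are maximal).
  record Run (n : ℕ) : Set where
    field
      state : ℕ → GState n
      input : ℕ → GInput n
      mover : ℕ → Proc n
      startA : proj₁ (state 0) ≡ init A
      startB : ∀ i → proj₂ (state 0) i ≡ init B
      step   : ∀ t → Step (mover t) (state t) (input t) (state (suc t)) (input (suc t))

  open Run public

  MovesInfOften : ∀ {n} → Run n → Proc n → Set
  MovesInfOften r p = ∀ t → ∃ λ t' → (t ≤ t') × (mover r t' ≡ p)

  UncondFair : ∀ {n} → Run n → Set
  UncondFair r = ∀ p → MovesInfOften r p

  Initializing : ∀ {n} → Run n → Set
  Initializing r = ∀ p → MovesInfOften r p →
                   ∀ t → ∃ λ t' → (t ≤ t') × IsInit p (state r t')

data LTL (qa sa qb sb : ℕ) : Set where
  tt     : LTL qa sa qb sb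
  stA    : Fin qa → LTL qa sa qb sb
  inA    : Fin sa → LTL qa sa qb sb
  stB1   : Fin qb → LTL qa sa qb sb
  inB1   : Fin sb → LTL qa sa qb sb
  ¬ₗ_    : LTL qa sa qb sb → LTL qa sa qb sb
  _∧ₗ_   : LTL qa sa qb sb → LTL qa sa qb sb → LTL qa sa qb sb
  _Uₗ_   : LTL qa sa qb sb → LTL qa sa qb sb → LTL qa sa qb sb

Obs : ℕ → ℕ → ℕ → ℕ → Set
Obs qa sa qb sb = Fin qa × Fin sa × Fin qb × Fin sb

_,_⊨_ : ∀ {qa sa qb sb} → (ℕ → Obs qa sa qb sb) → ℕ → LTL qa sa qb sb → Set
w , i ⊨ tt       = ⊤
w , i ⊨ stA q    = proj₁ (w i) ≡ q
w , i ⊨ inA σ    = proj₁ (proj₂ (w i)) ≡ σ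
w , i ⊨ stB1 q   = proj₁ (proj₂ (proj₂ (w i))) ≡ q
w , i ⊨ inB1 σ   = proj₂ (proj₂ (proj₂ (w i))) ≡ σ
w , i ⊨ (¬ₗ φ)   = ¬ (w , i ⊨ φ)
w , i ⊨ (φ ∧ₗ ψ) = (w , i ⊨ φ) × (w , i ⊨ ψ)
w , i ⊨ (φ Uₗ ψ) = ∃ λ k → (i ≤ k) × (w , k ⊨ ψ) × (∀ j → i ≤ j → j < k → w , j ⊨ φ)

module _ {qa qb sa sb : ℕ}
         (A : Template qa qb qa sa) (B : Template qa qb qb sb) where
  open System A B

  -- trace of (A, B_1) along a run of (A,B)^(1,m+1); B_1 is index zero
  trace : ∀ {m} → Run (suc m) → ℕ → Obs qa sa qb sb
  trace r t = proj₁ (state r t) , proj₁ (input r t) ,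
              proj₂ (state r t) zero , proj₂ (input r t) zero

  EUncond : (n : ℕ) → .{{NonZero n}} → LTL qa sa qb sb → Set
  EUncond (suc m) h = Σ (Run (suc m)) λ r →
    UncondFair r × Initializing r × (trace r , 0 ⊨ h)

{-# OPTIONS --safe #-}
-- Take a fair initializing run of (A,B)^(1,n) satisfying h and erase every move of B₂,…,Bₙ.
-- Such a move changes neither the local states nor the inputs of A and B₁, and a conjunctive
-- guard only constrains the other processes, so with fewer processes every remaining move is
-- still enabled: the remaining moves form a run of (A,B)^(1,1).  Its trace arises from the
-- trace of the original run by deleting stuttering, which LTL without X cannot detect, and A
-- and B₁ keep all their moves and all their visits to their initial states.
module Submission where

open import Defs
open import Data.Nat using (ℕ; NonZero; zero; suc; _+_; _∸_; _≤_; _<_; _<?_; _≤′_; ≤′-refl; ≤′-step; s≤s; s≤s⁻¹)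
open import Data.Nat.Properties
open import Data.Fin using (Fin; zero; suc)
open import Data.Product using (∃-syntax; _×_; _,_; proj₁; proj₂)
open import Data.Product.Function.NonDependent.Propositional using (_×-⇔_)
open import Data.Sum using (inj₁; inj₂)
open import Function using (id; _∘_; _⇔_; mk⇔; Equivalence)
open import Function.Related.TypeIsomorphisms using (¬-cong-⇔)
open import Level using (Level)
open import Relation.Nullary using (¬_; yes; no; contradiction)
open import Relation.Unary using (Pred; Decidable)
open import Relation.Binary.PropositionalEquality

open Equivalence using (to; from)

record FirstFrom {ℓ : Level} (P : Pred ℕ ℓ) (t : ℕ) : Set ℓ where
  field
    index   : ℕ
    t≤index : t ≤ index
    holds   : P index
    misses  : ∀ {j} → t ≤ j → j < index → ¬ P j

open FirstFrom

module _ {ℓ : Level} {P : Pred ℕ ℓ} (P? : Decidable P) where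

  first-within : ∀ d t → P (d + t) → FirstFrom P t
  first-within d t p with P? t
  ... | yes pt = record { index = t ; t≤index = ≤-refl ; holds = pt
                        ; misses = λ t≤j j<t → contradiction t≤j (<⇒≱ j<t) }
  first-within zero    t p | no ¬pt = contradiction p ¬pt
  first-within (suc d) t p | no ¬pt = record
    { index   = index next
    ; t≤index = <⇒≤ (t≤index next)
    ; holds   = holds next
    ; misses  = misses′
    }
    where
    next : FirstFrom P (suc t)
    next = first-within d (suc t) (subst P (sym (+-suc d t)) p)

    misses′ : ∀ {j} → t ≤ j → j < index next → ¬ P j
    misses′ t≤j j<i with m≤n⇒m<n∨m≡n t≤j
    ... | inj₁ t<j  = misses next t<j j<i
    ... | inj₂ refl = ¬pt

  first-from : ∀ {t} → ∃[ u ] t ≤ u × P u → FirstFrom P t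
  first-from {t} (u , t≤u , pu) = first-within (u ∸ t) t (subst P (sym (m∸n+n≡m t≤u)) pu)

module Blocks (s : ℕ → ℕ) (s-zero : s 0 ≡ 0) (s-step : ∀ k → s k < s (suc k)) where

  s-mono-≤′ : ∀ {a b} → a ≤′ b → s a ≤ s b
  s-mono-≤′ ≤′-refl        = ≤-refl
  s-mono-≤′ (≤′-step a≤′b) = ≤-trans (s-mono-≤′ a≤′b) (<⇒≤ (s-step _))

  s-mono-≤ : ∀ {a b} → a ≤ b → s a ≤ s b
  s-mono-≤ = s-mono-≤′ ∘ ≤⇒≤′

  s-cancel-< : ∀ {a b} → s a < s b → a < b
  s-cancel-< sa<sb = ≰⇒> (λ b≤a → <⇒≱ sa<sb (s-mono-≤ b≤a))

  InBlock : ℕ → ℕ → Set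
  InBlock k t = s k ≤ t × t < s (suc k)

  start-in-block : ∀ k → InBlock k (s k)
  start-in-block k = ≤-refl , s-step k

  block-of : ∀ t → ∃[ k ] InBlock k t
  block-of zero = 0 , ≤-reflexive s-zero , ≤-<-trans (≤-reflexive (sym s-zero)) (s-step 0)
  block-of (suc t) with block-of t
  ... | k , sk≤t , t<end with suc t <? s (suc k)
  ...   | yes t+1<end = k , m≤n⇒m≤1+n sk≤t , t+1<end
  ...   | no  t+1≮end = suc k , ≮⇒≥ t+1≮end , <-≤-trans (s≤s t<end) (s-step (suc k))

  block-mono : ∀ {k k′ t t′} → InBlock k t → InBlock k′ t′ → t ≤ t′ → k ≤ k′
  block-mono (sk≤t , _) (_ , t′<end) t≤t′ =
    s≤s⁻¹ (s-cancel-< (≤-<-trans (≤-trans sk≤t t≤t′) t′<end))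

  block-earlier : ∀ {k k′ t t′} → InBlock k t → InBlock k′ t′ → k < k′ → t < t′
  block-earlier (_ , t<end) (sk′≤t′ , _) k<k′ = <-≤-trans t<end (≤-trans (s-mono-≤ k<k′) sk′≤t′)

  later-time-in-block : ∀ {k k′ t} → InBlock k t → k ≤ k′ → ∃[ t′ ] t ≤ t′ × InBlock k′ t′
  later-time-in-block {k′ = k′} {t} t∈k k≤k′ with m≤n⇒m<n∨m≡n k≤k′
  ... | inj₂ refl = t , ≤-refl , t∈k
  ... | inj₁ k<k′ = s k′ , <⇒≤ (block-earlier t∈k (start-in-block k′) k<k′) , start-in-block k′

  module Stuttering {qa sa qb sb : ℕ} (w w′ : ℕ → Obs qa sa qb sb)
                    (constant : ∀ {k t} → InBlock k t → w t ≡ w′ k) where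

    subst-⇔ : (P : Obs qa sa qb sb → Set) → ∀ {o o′} → o ≡ o′ → P o ⇔ P o′
    subst-⇔ P o≡o′ = mk⇔ (subst P o≡o′) (subst P (sym o≡o′))

    ⊨-stutter-invariant : ∀ φ {k t} → InBlock k t → (w , t ⊨ φ) ⇔ (w′ , k ⊨ φ)
    ⊨-stutter-invariant tt       t∈k = mk⇔ id id
    ⊨-stutter-invariant (stA q)  t∈k = subst-⇔ (λ o → proj₁ o ≡ q) (constant t∈k)
    ⊨-stutter-invariant (inA σ)  t∈k = subst-⇔ (λ o → proj₁ (proj₂ o) ≡ σ) (constant t∈k)
    ⊨-stutter-invariant (stB1 q) t∈k = subst-⇔ (λ o → proj₁ (proj₂ (proj₂ o)) ≡ q) (constant t∈k)
    ⊨-stutter-invariant (inB1 σ) t∈k = subst-⇔ (λ o → proj₂ (proj₂ (proj₂ o)) ≡ σ) (constant t∈k)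
    ⊨-stutter-invariant (¬ₗ φ)   t∈k = ¬-cong-⇔ (⊨-stutter-invariant φ t∈k)
    ⊨-stutter-invariant (φ ∧ₗ ψ) t∈k = ⊨-stutter-invariant φ t∈k ×-⇔ ⊨-stutter-invariant ψ t∈k
    ⊨-stutter-invariant (φ Uₗ ψ) {k} {t} t∈k = mk⇔ forth back
      where
      forth : w , t ⊨ (φ Uₗ ψ) → w′ , k ⊨ (φ Uₗ ψ)
      forth (u , t≤u , ψu , φ<u) with block-of u
      ... | ku , u∈ku = ku , block-mono t∈k u∈ku t≤u , to (⊨-stutter-invariant ψ u∈ku) ψu , φ<ku
        where
        φ<ku : ∀ j → k ≤ j → j < ku → w′ , j ⊨ φ
        φ<ku j k≤j j<ku with later-time-in-block t∈k k≤j
        ... | t′ , t≤t′ , t′∈j =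
          to (⊨-stutter-invariant φ t′∈j) (φ<u t′ t≤t′ (block-earlier t′∈j u∈ku j<ku))

      back : w′ , k ⊨ (φ Uₗ ψ) → w , t ⊨ (φ Uₗ ψ)
      back (k′ , k≤k′ , ψk′ , φ<k′) with m≤n⇒m<n∨m≡n k≤k′
      ... | inj₂ refl = t , ≤-refl , from (⊨-stutter-invariant ψ t∈k) ψk′ ,
                        λ j t≤j j<t → contradiction t≤j (<⇒≱ j<t)
      ... | inj₁ k<k′ = s k′ , <⇒≤ (block-earlier t∈k (start-in-block k′) k<k′) ,
                        from (⊨-stutter-invariant ψ (start-in-block k′)) ψk′ , φ<sk′
        where
        φ<sk′ : ∀ j → t ≤ j → j < s k′ → w , j ⊨ φ
        φ<sk′ j t≤j j<sk′ with block-of j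
        ... | kj , j∈kj = from (⊨-stutter-invariant φ j∈kj)
                            (φ<k′ kj (block-mono t∈k j∈kj t≤j) (s-cancel-< (≤-<-trans (proj₁ j∈kj) j<sk′)))

data Observed {m : ℕ} : Proc (suc m) → Set where
  A-observed  : Observed procA
  B₁-observed : Observed (procB zero)

observed? : ∀ {m} → Decidable (Observed {m})
observed? procA           = yes A-observed
observed? (procB zero)    = yes B₁-observed
observed? (procB (suc i)) = no λ ()

project : ∀ {m} → Proc (suc m) → Proc 1
project procA     = procA
project (procB _) = procB zero

module Erasure {qa qb sa sb : ℕ} (A : Template qa qb qa sa) (B : Template qa qb qb sb)
               {m : ℕ} (r : System.Run A B (suc m))
               (A-often : System.MovesInfOften A B r procA) where
  open System A B

  w : ℕ → Obs qa sa qb sb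
  w = trace A B r

  unobserved-step-keeps-trace : ∀ t → ¬ Observed (mover r t) → w (suc t) ≡ w t
  unobserved-step-keeps-trace t ¬obs with mover r t | step r t
  ... | procA         | _ = contradiction A-observed ¬obs
  ... | procB zero    | _ = contradiction B₁-observed ¬obs
  ... | procB (suc i) | (_ , _ , _ , _ , a′≡a , bs′≡bs , σ′≡σ , τs′≡τs) =
    cong₂ _,_ a′≡a (cong₂ _,_ σ′≡σ (cong₂ _,_ (bs′≡bs zero λ ()) (τs′≡τs zero λ ())))

  toState : Obs qa sa qb sb → GState 1
  toState (a , _ , b , _) = a , λ _ → b

  toInput : Obs qa sa qb sb → GInput 1
  toInput (_ , σ , _ , τ) = σ , λ _ → τ

  observed-step : ∀ u → Observed (mover r u) →
    Step (project (mover r u)) (toState (w u)) (toInput (w u)) (toState (w (suc u))) (toInput (w (suc u)))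
  observed-step u obs with mover r u | step r u
  observed-step u A-observed  | procA      | (g , move , bs∈g , bs′≡bs , τs′≡τs) =
    g , move , (λ _ → bs∈g zero) , (λ _ → bs′≡bs zero) , (λ _ → τs′≡τs zero)
  observed-step u B₁-observed | procB zero | (g , move , a∈g , _ , a′≡a , _ , σ′≡σ , _) =
    g , move , a∈g , only-B₁ , a′≡a , only-B₁ , σ′≡σ , only-B₁
    where
    only-B₁ : ∀ {P : Fin 1 → Set} j → j ≢ zero → P j
    only-B₁ zero j≢0 = contradiction refl j≢0

  next-observed : ∀ t → FirstFrom (Observed ∘ mover r) t
  next-observed t with A-often t
  ... | u , t≤u , mover≡A =
    first-from (observed? ∘ mover r) (u , t≤u , subst Observed (sym mover≡A) A-observed)

  start : ℕ → ℕ
  start zero    = 0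
  start (suc k) = suc (index (next-observed (start k)))

  end : ℕ → ℕ
  end k = index (next-observed (start k))

  open Blocks start refl (λ k → s≤s (t≤index (next-observed (start k))))

  end-in-block : ∀ k → InBlock k (end k)
  end-in-block k = t≤index (next-observed (start k)) , ≤-refl

  observed-in-block-is-end : ∀ {k t} → InBlock k t → Observed (mover r t) → end k ≡ t
  observed-in-block-is-end {k} (sk≤t , t≤end) obs with m≤n⇒m<n∨m≡n (s≤s⁻¹ t≤end)
  ... | inj₁ t<end  = contradiction obs (misses (next-observed (start k)) sk≤t t<end)
  ... | inj₂ t≡end = sym t≡end

  trace-constant-on-block : ∀ {k t} → InBlock k t → w t ≡ w (start k)
  trace-constant-on-block {k} (sk≤t , t≤end) = go (≤⇒≤′ sk≤t) (s≤s⁻¹ t≤end)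
    where
    go : ∀ {t} → start k ≤′ t → t ≤ end k → w t ≡ w (start k)
    go ≤′-refl             _     = refl
    go (≤′-step {t} sk≤′t) t<end = begin
      w (suc t)   ≡⟨ unobserved-step-keeps-trace t (misses (next-observed (start k)) (≤′⇒≤ sk≤′t) t<end) ⟩
      w t         ≡⟨ go sk≤′t (<⇒≤ t<end) ⟩
      w (start k) ∎
      where open ≡-Reasoning

  erased : Run 1
  erased = record
    { state  = toState ∘ w ∘ start
    ; input  = toInput ∘ w ∘ start
    ; mover  = project ∘ mover r ∘ end
    ; startA = startA r
    ; startB = λ _ → startB r zero
    ; step   = λ k → subst (λ o → Step (project (mover r (end k))) (toState o) (toInput o)
                                       (toState (w (start (suc k)))) (toInput (w (start (suc k)))))
                           (trace-constant-on-block (end-in-block k))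
                           (observed-step (end k) (holds (next-observed (start k))))
    }

  moves-preserved : ∀ {p} → Observed p → MovesInfOften r p → MovesInfOften erased (project p)
  moves-preserved obs often k with often (start k)
  ... | t , sk≤t , mover≡p with block-of t
  ... | k′ , t∈k′ = k′ , block-mono (start-in-block k) t∈k′ sk≤t ,
    trans (cong (project ∘ mover r) (observed-in-block-is-end t∈k′ (subst Observed (sym mover≡p) obs)))
          (cong project mover≡p)

  isInit-by-trace : ∀ {p t u} → Observed p → w t ≡ w u → IsInit p (state r t) → IsInit (project p) (toState (w u))
  isInit-by-trace A-observed  = subst (λ o → proj₁ o ≡ init A)
  isInit-by-trace B₁-observed = subst (λ o → proj₁ (proj₂ (proj₂ o)) ≡ init B)

  visits-preserved : ∀ {p} → Observed p → (∀ t → ∃[ t′ ] t ≤ t′ × IsInit p (state r t′)) →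
                     ∀ k → ∃[ k′ ] k ≤ k′ × IsInit (project p) (state erased k′)
  visits-preserved obs visits k with visits (start k)
  ... | t , sk≤t , init-at-t with block-of t
  ... | k′ , t∈k′ = k′ , block-mono (start-in-block k) t∈k′ sk≤t ,
                    isInit-by-trace obs (trace-constant-on-block t∈k′) init-at-t

  erased-fair : UncondFair r → UncondFair erased
  erased-fair fair procA        = moves-preserved A-observed (fair procA)
  erased-fair fair (procB zero) = moves-preserved B₁-observed (fair (procB zero))

  erased-initializing : UncondFair r → Initializing r → Initializing erased
  erased-initializing fair ini procA        _ = visits-preserved A-observed (ini procA (fair procA))
  erased-initializing fair ini (procB zero) _ = visits-preserved B₁-observed (ini (procB zero) (fair (procB zero)))

  erased-⊨ : ∀ φ → (w , 0 ⊨ φ) ⇔ (trace A B erased , 0 ⊨ φ)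
  erased-⊨ φ = Stuttering.⊨-stutter-invariant w (w ∘ start) trace-constant-on-block φ (start-in-block 0)

mainTheorem13 : ∀ {qa qb sa sb} (A : Template qa qb qa sa) (B : Template qa qb qb sb) → InitInGuards A B → (n : ℕ) → .{{_ : NonZero n}} → (h : LTL qa sa qb sb) → EUncond A B n h → EUncond A B 1 h
mainTheorem13 A B _ (suc m) h (r , fair , ini , r⊨h) =
  erased , erased-fair fair , erased-initializing fair ini , to (erased-⊨ h) r⊨h
  where open Erasure A B r (fair procA)
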